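{- A graph $G$ on $n$ vertices is a uniquely $C_4^{+}$-saturated graph with girth $4$ if and only if $G$ is a strongly regular graph with parameters $(n,k,0,2)$ for some $k$.
   Context: All graphs are finite, simple and undirected. $C_4^{+}$ (the diamond) is the graph obtained from a $4$-cycle by adding one chord, i.e. $K_4$ minus an edge. For a graph $H$, a graph $G$ is uniquely $H$-saturated if $G$ contains no subgraph isomorphic to $H$, but for every pair of non-adjacent vertices $u,v$ of $G$, the graph $G+uv$ contains exactly one subgraph isomorphic to $H$. The girth is the minimum length of a cycle. A graph on $n$ vertices is strongly regular with parameters $(n,k,\lambda,\mu)$ if it is neither complete nor edgeless, every vertex has degree $k$, every pair of adjacent vertices has exactly $\lambda$ common neighbors, and every pair of non-adjacent vertices has exactly $\mu$ common neighbors. -}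

module Defs where

open import Level using (0ℓ)
open import Data.Nat using (ℕ; zero; suc; _+_)
open import Data.Bool using (Bool; true; false; _∧_; if_then_else_)
open import Data.Fin using (Fin; zero; suc)
open import Data.Product using (Σ; ∃; ∃-syntax; _×_; _,_)
open import Data.Sum using (_⊎_)
open import Relation.Nullary using (¬_)
open import Relation.Binary.PropositionalEquality using (_≡_; _≢_)
open import Function.Bundles using (_⇔_)

record Graph (n : ℕ) : Set where
  field
    adj : Fin n → Fin n → Bool
    sym : ∀ x y → adj x y ≡ adj y x
    irr : ∀ x → adj x x ≡ false
open Graph public

E : ∀ {n} → Graph n → Fin n → Fin n → Set
E G x y = adj G x y ≡ true

E+ : ∀ {n} → Graph n → Fin n → Fin n → Fin n → Fin n → Set
E+ G u v x y = E G x y ⊎ ((x ≡ u × y ≡ v) ⊎ (x ≡ v × y ≡ u))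

count : ∀ {n} → (Fin n → Bool) → ℕ
count {zero}  f = 0
count {suc n} f = (if f zero then 1 else 0) + count (λ i → f (suc i))

degree : ∀ {n} → Graph n → Fin n → ℕ
degree G x = count (adj G x)

commonNeighbours : ∀ {n} → Graph n → Fin n → Fin n → ℕ
commonNeighbours G x y = count (λ w → adj G x w ∧ adj G y w)

-- Diamond (C4⁺ = K4 minus an edge) subgraphs of an edge relation R.
-- A copy is given by four distinct vertices a b c d with edges
-- ab, ac, bc, bd, cd (bc is the chord; ad is not required/used).

record Diamond {n : ℕ} (R : Fin n → Fin n → Set) : Set where
  constructor diamond
  field
    a b c d : Fin n
    ab : a ≢ b
    ac : a ≢ c
    ad : a ≢ d
    bc : b ≢ c
    bd : b ≢ d
    cd : c ≢ d
    eab : R a b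
    eac : R a c
    ebc : R b c
    ebd : R b d
    ecd : R c d

UPair : ∀ {n} → Fin n → Fin n → Fin n → Fin n → Set
UPair x y p q = (x ≡ p × y ≡ q) ⊎ (x ≡ q × y ≡ p)

DEdge : ∀ {n} {R : Fin n → Fin n → Set} → Diamond R → Fin n → Fin n → Set
DEdge D x y =
  UPair x y a b ⊎ (UPair x y a c ⊎ (UPair x y b c ⊎ (UPair x y b d ⊎ UPair x y c d)))
  where open Diamond D

-- two copies are the same subgraph iff they have the same edge set
-- (a diamond has no isolated vertices, so the edge set determines it)
SameSubgraph : ∀ {n} {R : Fin n → Fin n → Set} → Diamond R → Diamond R → Set
SameSubgraph D D' = ∀ x y → DEdge D x y ⇔ DEdge D' x y

ExactlyOneDiamond : ∀ {n} → (Fin n → Fin n → Set) → Set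
ExactlyOneDiamond R = Σ (Diamond R) λ D → ∀ (D' : Diamond R) → SameSubgraph D D'

UniquelyDiamondSaturated : ∀ {n} → Graph n → Set
UniquelyDiamondSaturated {n} G =
  ¬ Diamond (E G) ×
  (∀ (u v : Fin n) → u ≢ v → ¬ E G u v → ExactlyOneDiamond (E+ G u v))

HasTriangle : ∀ {n} → Graph n → Set
HasTriangle {n} G = Σ (Fin n) λ a → Σ (Fin n) λ b → Σ (Fin n) λ c →
  E G a b × E G b c × E G c a

Has4Cycle : ∀ {n} → Graph n → Set
Has4Cycle {n} G = Σ (Fin n) λ a → Σ (Fin n) λ b → Σ (Fin n) λ c → Σ (Fin n) λ d →
  (a ≢ b × a ≢ c × a ≢ d × b ≢ c × b ≢ d × c ≢ d) ×
  (E G a b × E G b c × E G c d × E G d a)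

Girth4 : ∀ {n} → Graph n → Set
Girth4 G = ¬ HasTriangle G × Has4Cycle G

IsComplete : ∀ {n} → Graph n → Set
IsComplete {n} G = ∀ (x y : Fin n) → x ≢ y → E G x y

IsEdgeless : ∀ {n} → Graph n → Set
IsEdgeless {n} G = ∀ (x y : Fin n) → ¬ E G x y

StronglyRegular : ∀ {n} → Graph n → ℕ → ℕ → ℕ → ℕ → Set
StronglyRegular {n} G v k λ' μ =
  v ≡ n ×
  ¬ IsComplete G ×
  ¬ IsEdgeless G ×
  (∀ x → degree G x ≡ k) ×
  (∀ x y → E G x y → commonNeighbours G x y ≡ λ') ×
  (∀ x y → x ≢ y → ¬ E G x y → commonNeighbours G x y ≡ μ)

{-# OPTIONS --safe #-}
-- Triangle-freeness is λ = 0. In a triangle-free graph G every triangle of G + uv contains the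
-- new edge uv, so a diamond of G + uv has uv as its chord and two common neighbours of u and v as
-- its other vertices: G + uv has exactly one diamond iff u and v have exactly two common
-- neighbours. Regularity follows from λ = 0 and μ = 2: for adjacent x and y, matching y with x and
-- every other neighbour z of x with the common neighbour of z and y other than x is a bijection
-- between the neighbourhoods of x and y. A 4-cycle in a triangle-free graph has a non-adjacent
-- diagonal, and conversely a non-edge with its two common neighbours is a 4-cycle.
module Submission where

open import Defs
open import Data.Nat using (ℕ)
open import Data.Product using (∃; _×_)
open import Function.Bundles using (_⇔_)

open import Axiom.UniquenessOfIdentityProofs using (module Decidable⇒UIP)
open import Data.Bool using (Bool; true; false; _∧_; if_then_else_)
open import Data.Bool.Properties using (∧-conicalˡ; ∧-conicalʳ) renaming (_≟_ to _≟ᵇ_)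
open import Data.Empty using (⊥-elim)
open import Data.Fin using (Fin; zero; suc)
open import Data.Fin.Permutation using (↔⇒≡)
open import Data.Fin.Properties using (_≟_; ¬Fin0; +↔⊎; ¬∀⟶∃¬; all?)
open import Data.Nat using (zero; suc)
open import Data.Product using (Σ; _,_; proj₁; proj₂)
open import Data.Sum using (_⊎_; inj₁; inj₂; [_,_]′)
open import Data.Sum.Function.Propositional using (_⊎-↔_)
open import Function.Base using (_∘_; id)
open import Function.Bundles using (_↔_; mk↔ₛ′; mk⇔; Equivalence; Inverse)
open import Function.Construct.Composition using (_↔-∘_; _⇔-∘_)
open import Function.Construct.Symmetry using (↔-sym; ⇔-sym)
open import Relation.Nullary using (¬_; Dec; yes; no; ¬?; _→-dec_)
open import Relation.Binary.PropositionalEquality as ≡ using (_≡_; _≢_; refl; trans; cong; cong₂; subst)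

Support : ∀ {n} → (Fin n → Bool) → Set
Support {n} P = Σ (Fin n) λ z → P z ≡ true

Support-≡ : ∀ {n} {P : Fin n → Bool} {s t : Support P} → proj₁ s ≡ proj₁ t → s ≡ t
Support-≡ {s = z , e} {t = .z , e′} refl = cong (z ,_) (Decidable⇒UIP.≡-irrelevant _≟ᵇ_ e e′)

Support-suc-↔ : ∀ {n} (P : Fin (suc n) → Bool) → Support P ↔ (P zero ≡ true ⊎ Support (P ∘ suc))
Support-suc-↔ P = mk↔ₛ′ to from to∘from from∘to
  where
  to : Support P → P zero ≡ true ⊎ Support (P ∘ suc)
  to (zero , e) = inj₁ e
  to (suc z , e) = inj₂ (z , e)
  from : P zero ≡ true ⊎ Support (P ∘ suc) → Support P
  from (inj₁ e) = zero , e
  from (inj₂ (z , e)) = suc z , e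
  to∘from : ∀ s → to (from s) ≡ s
  to∘from (inj₁ _) = refl
  to∘from (inj₂ _) = refl
  from∘to : ∀ s → from (to s) ≡ s
  from∘to (zero , _) = refl
  from∘to (suc _ , _) = refl

≡true↔Fin : (b : Bool) → (b ≡ true) ↔ Fin (if b then 1 else 0)
≡true↔Fin true = mk↔ₛ′ (λ _ → zero) (λ _ → refl) (λ { zero → refl ; (suc ()) }) (λ { refl → refl })
≡true↔Fin false = mk↔ₛ′ (λ ()) (λ ()) (λ ()) (λ ())

count-↔ : ∀ {n} (P : Fin n → Bool) → Support P ↔ Fin (count P)
count-↔ {zero} P = mk↔ₛ′ (λ { (() , _) }) (λ ()) (λ ()) (λ { (() , _) })
count-↔ {suc n} P = ↔-sym +↔⊎ ↔-∘ ((≡true↔Fin (P zero) ⊎-↔ count-↔ (P ∘ suc)) ↔-∘ Support-suc-↔ P)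

count≡⇔↔ : ∀ {n m} (P : Fin n → Bool) → count P ≡ m ⇔ (Support P ↔ Fin m)
count≡⇔↔ P = mk⇔ (λ eq → subst (λ m → Support P ↔ Fin m) eq (count-↔ P))
                  (λ I → ↔⇒≡ (I ↔-∘ ↔-sym (count-↔ P)))

count-cong-↔ : ∀ {n} {P Q : Fin n → Bool} → Support P ↔ Support Q → count P ≡ count Q
count-cong-↔ {Q = Q} I = Equivalence.from (count≡⇔↔ _) (count-↔ Q ↔-∘ I)

count≡0⇔ : ∀ {n} (P : Fin n → Bool) → count P ≡ 0 ⇔ (∀ z → P z ≢ true)
count≡0⇔ P = mk⇔ (λ eq z e → ¬Fin0 (Inverse.to (Equivalence.to (count≡⇔↔ P) eq) (z , e)))
                 (λ none → Equivalence.from (count≡⇔↔ P) (mk↔ₛ′ (λ (z , e) → ⊥-elim (none z e))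
                                                                 (λ ()) (λ ()) (λ (z , e) → ⊥-elim (none z e))))

record ExactlyTwo {n} (P : Fin n → Set) : Set where
  constructor exactlyTwo
  field
    fst snd    : Fin n
    fst≢snd    : fst ≢ snd
    P-fst      : P fst
    P-snd      : P snd
    fst-or-snd : ∀ z → P z → z ≡ fst ⊎ z ≡ snd

  partner : ∀ {x} → P x → Σ (Fin n) λ w → P w × w ≢ x × (∀ w′ → P w′ → w′ ≢ x → w′ ≡ w)
  partner {x} px with fst-or-snd x px
  ... | inj₁ refl = snd , P-snd , fst≢snd ∘ ≡.sym ,
                      λ w′ pw′ w′≢x → [ ⊥-elim ∘ w′≢x , id ]′ (fst-or-snd w′ pw′)
  ... | inj₂ refl = fst , P-fst , fst≢snd ,
                      λ w′ pw′ w′≢x → [ id , ⊥-elim ∘ w′≢x ]′ (fst-or-snd w′ pw′)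

  UPair-fst-snd : ∀ {x y} → x ≢ y → P x → P y → UPair x y fst snd
  UPair-fst-snd {x} {y} x≢y px py with fst-or-snd x px | fst-or-snd y py
  ... | inj₁ refl | inj₁ refl = ⊥-elim (x≢y refl)
  ... | inj₂ refl | inj₂ refl = ⊥-elim (x≢y refl)
  ... | inj₁ x≡fst | inj₂ y≡snd = inj₁ (x≡fst , y≡snd)
  ... | inj₂ x≡snd | inj₁ y≡fst = inj₂ (x≡snd , y≡fst)

ExactlyTwo-map : ∀ {n} {P Q : Fin n → Set} → (∀ z → P z ⇔ Q z) → ExactlyTwo P → ExactlyTwo Q
ExactlyTwo-map P⇔Q (exactlyTwo p q p≢q Pp Pq p-or-q) =
  exactlyTwo p q p≢q (Equivalence.to (P⇔Q p) Pp) (Equivalence.to (P⇔Q q) Pq)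
    (λ z → p-or-q z ∘ Equivalence.from (P⇔Q z))

ExactlyTwo⇔↔Fin2 : ∀ {n} (P : Fin n → Bool) → ExactlyTwo (λ z → P z ≡ true) ⇔ (Support P ↔ Fin 2)
ExactlyTwo⇔↔Fin2 P = mk⇔ enumerate fromEnumeration
  where
  enumerate : ExactlyTwo (λ z → P z ≡ true) → Support P ↔ Fin 2
  enumerate (exactlyTwo p q p≢q Pp Pq p-or-q) = mk↔ₛ′ to from to∘from from∘to
    where
    to : Support P → Fin 2
    to (z , _) with z ≟ p
    ... | yes _ = zero
    ... | no _ = suc zero
    from : Fin 2 → Support P
    from zero = p , Pp
    from (suc zero) = q , Pq
    to∘from : ∀ i → to (from i) ≡ i
    to∘from zero with p ≟ p
    ... | yes _ = refl
    ... | no p≢p = ⊥-elim (p≢p refl)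
    to∘from (suc zero) with q ≟ p
    ... | yes q≡p = ⊥-elim (p≢q (≡.sym q≡p))
    ... | no _ = refl
    from∘to : ∀ s → from (to s) ≡ s
    from∘to (z , e) with z ≟ p
    ... | yes z≡p = Support-≡ (≡.sym z≡p)
    ... | no z≢p with p-or-q z e
    ...   | inj₁ z≡p = ⊥-elim (z≢p z≡p)
    ...   | inj₂ z≡q = Support-≡ (≡.sym z≡q)
  fromEnumeration : Support P ↔ Fin 2 → ExactlyTwo (λ z → P z ≡ true)
  fromEnumeration I = exactlyTwo (proj₁ (from zero)) (proj₁ (from (suc zero))) distinct
                        (proj₂ (from zero)) (proj₂ (from (suc zero))) enumerated
    where
    open Inverse I
    distinct : proj₁ (from zero) ≢ proj₁ (from (suc zero))
    distinct eq with () ← trans (≡.sym (strictlyInverseˡ zero))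
                                 (trans (cong to (Support-≡ eq)) (strictlyInverseˡ (suc zero)))
    enumerated : ∀ z → P z ≡ true → z ≡ proj₁ (from zero) ⊎ z ≡ proj₁ (from (suc zero))
    enumerated z e with to (z , e) | strictlyInverseʳ (z , e)
    ... | zero | from∘to = inj₁ (cong proj₁ (≡.sym from∘to))
    ... | suc zero | from∘to = inj₂ (cong proj₁ (≡.sym from∘to))

count≡2⇔ : ∀ {n} (P : Fin n → Bool) → count P ≡ 2 ⇔ ExactlyTwo (λ z → P z ≡ true)
count≡2⇔ P = ⇔-sym (ExactlyTwo⇔↔Fin2 P) ⇔-∘ count≡⇔↔ P

module _ {n : ℕ} where

  UPair-flip : {x y p q : Fin n} → UPair x y p q → UPair x y q p
  UPair-flip (inj₁ eqs) = inj₂ eqs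
  UPair-flip (inj₂ eqs) = inj₁ eqs

  UPair-sym : {x y p q : Fin n} → UPair x y p q → UPair p q x y
  UPair-sym (inj₁ (x≡p , y≡q)) = inj₁ (≡.sym x≡p , ≡.sym y≡q)
  UPair-sym (inj₂ (x≡q , y≡p)) = inj₂ (≡.sym y≡p , ≡.sym x≡q)

  UPair-endpoint : {x y x′ y′ u v : Fin n} → UPair x y u v → UPair x′ y′ u v → x ≡ x′ ⊎ x ≡ y′
  UPair-endpoint (inj₁ (refl , refl)) (inj₁ (refl , refl)) = inj₁ refl
  UPair-endpoint (inj₁ (refl , refl)) (inj₂ (refl , refl)) = inj₂ refl
  UPair-endpoint (inj₂ (refl , refl)) (inj₁ (refl , refl)) = inj₂ refl
  UPair-endpoint (inj₂ (refl , refl)) (inj₂ (refl , refl)) = inj₁ refl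

  DiamondEdge : Fin n → Fin n → Fin n → Fin n → Fin n → Fin n → Set
  DiamondEdge a b c d x y =
    UPair x y a b ⊎ (UPair x y a c ⊎ (UPair x y b c ⊎ (UPair x y b d ⊎ UPair x y c d)))

  DiamondEdge-swapᵇᶜ : {a b c d x y : Fin n} → DiamondEdge a b c d x y → DiamondEdge a c b d x y
  DiamondEdge-swapᵇᶜ (inj₁ ab) = inj₂ (inj₁ ab)
  DiamondEdge-swapᵇᶜ (inj₂ (inj₁ ac)) = inj₁ ac
  DiamondEdge-swapᵇᶜ (inj₂ (inj₂ (inj₁ bc))) = inj₂ (inj₂ (inj₁ (UPair-flip bc)))
  DiamondEdge-swapᵇᶜ (inj₂ (inj₂ (inj₂ (inj₁ bd)))) = inj₂ (inj₂ (inj₂ (inj₂ bd)))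
  DiamondEdge-swapᵇᶜ (inj₂ (inj₂ (inj₂ (inj₂ cd)))) = inj₂ (inj₂ (inj₂ (inj₁ cd)))

  DiamondEdge-swapᵃᵈ : {a b c d x y : Fin n} → DiamondEdge a b c d x y → DiamondEdge d b c a x y
  DiamondEdge-swapᵃᵈ (inj₁ ab) = inj₂ (inj₂ (inj₂ (inj₁ (UPair-flip ab))))
  DiamondEdge-swapᵃᵈ (inj₂ (inj₁ ac)) = inj₂ (inj₂ (inj₂ (inj₂ (UPair-flip ac))))
  DiamondEdge-swapᵃᵈ (inj₂ (inj₂ (inj₁ bc))) = inj₂ (inj₂ (inj₁ bc))
  DiamondEdge-swapᵃᵈ (inj₂ (inj₂ (inj₂ (inj₁ bd)))) = inj₁ (UPair-flip bd)
  DiamondEdge-swapᵃᵈ (inj₂ (inj₂ (inj₂ (inj₂ cd)))) = inj₂ (inj₁ (UPair-flip cd))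

  DiamondEdge-cong : {a b c d a′ b′ c′ d′ x y : Fin n} → UPair b c b′ c′ → UPair a d a′ d′ →
                     DiamondEdge a b c d x y → DiamondEdge a′ b′ c′ d′ x y
  DiamondEdge-cong (inj₁ (refl , refl)) (inj₁ (refl , refl)) = id
  DiamondEdge-cong (inj₂ (refl , refl)) (inj₁ (refl , refl)) = DiamondEdge-swapᵇᶜ
  DiamondEdge-cong (inj₁ (refl , refl)) (inj₂ (refl , refl)) = DiamondEdge-swapᵃᵈ
  DiamondEdge-cong (inj₂ (refl , refl)) (inj₂ (refl , refl)) = DiamondEdge-swapᵃᵈ ∘ DiamondEdge-swapᵇᶜ

  DiamondEdge-off-chord : {a b c d x y : Fin n} → DiamondEdge a b c d x y → x ≢ b → x ≢ c → x ≡ a ⊎ x ≡ d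
  DiamondEdge-off-chord (inj₁ (inj₁ (x≡a , _))) _ _ = inj₁ x≡a
  DiamondEdge-off-chord (inj₁ (inj₂ (x≡b , _))) x≢b _ = ⊥-elim (x≢b x≡b)
  DiamondEdge-off-chord (inj₂ (inj₁ (inj₁ (x≡a , _)))) _ _ = inj₁ x≡a
  DiamondEdge-off-chord (inj₂ (inj₁ (inj₂ (x≡c , _)))) _ x≢c = ⊥-elim (x≢c x≡c)
  DiamondEdge-off-chord (inj₂ (inj₂ (inj₁ (inj₁ (x≡b , _))))) x≢b _ = ⊥-elim (x≢b x≡b)
  DiamondEdge-off-chord (inj₂ (inj₂ (inj₁ (inj₂ (x≡c , _))))) _ x≢c = ⊥-elim (x≢c x≡c)
  DiamondEdge-off-chord (inj₂ (inj₂ (inj₂ (inj₁ (inj₁ (x≡b , _)))))) x≢b _ = ⊥-elim (x≢b x≡b)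
  DiamondEdge-off-chord (inj₂ (inj₂ (inj₂ (inj₁ (inj₂ (x≡d , _)))))) _ _ = inj₂ x≡d
  DiamondEdge-off-chord (inj₂ (inj₂ (inj₂ (inj₂ (inj₁ (x≡c , _)))))) _ x≢c = ⊥-elim (x≢c x≡c)
  DiamondEdge-off-chord (inj₂ (inj₂ (inj₂ (inj₂ (inj₂ (x≡d , _)))))) _ _ = inj₂ x≡d

module _ {n : ℕ} (G : Graph n) where

  E? : ∀ x y → Dec (E G x y)
  E? x y = adj G x y ≟ᵇ true

  E-sym : ∀ {x y} → E G x y → E G y x
  E-sym {x} {y} = trans (sym G y x)

  E⇒≢ : ∀ {x y} → E G x y → x ≢ y
  E⇒≢ {x} loop refl with () ← trans (≡.sym (irr G x)) loop

  CommonNeighbour : Fin n → Fin n → Fin n → Set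
  CommonNeighbour x y z = E G x z × E G y z

  commonNeighbour⇔ : ∀ x y z → (adj G x z ∧ adj G y z ≡ true) ⇔ CommonNeighbour x y z
  commonNeighbour⇔ x y z =
    mk⇔ (λ e → ∧-conicalˡ _ _ e , ∧-conicalʳ _ _ e) (λ (xz , yz) → cong₂ _∧_ xz yz)

  commonNeighbours≡0⇔ : ∀ x y → commonNeighbours G x y ≡ 0 ⇔ (∀ z → ¬ CommonNeighbour x y z)
  commonNeighbours≡0⇔ x y =
    mk⇔ (λ none z → none z ∘ Equivalence.from (commonNeighbour⇔ x y z))
        (λ none z → none z ∘ Equivalence.to (commonNeighbour⇔ x y z))
    ⇔-∘ count≡0⇔ _

  commonNeighbours≡2⇔ : ∀ x y → commonNeighbours G x y ≡ 2 ⇔ ExactlyTwo (CommonNeighbour x y)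
  commonNeighbours≡2⇔ x y =
    mk⇔ (ExactlyTwo-map (commonNeighbour⇔ x y)) (ExactlyTwo-map (⇔-sym ∘ commonNeighbour⇔ x y))
    ⇔-∘ count≡2⇔ _

  triangleFree⇔λ≡0 : (¬ HasTriangle G) ⇔ (∀ x y → E G x y → commonNeighbours G x y ≡ 0)
  triangleFree⇔λ≡0 = mk⇔
    (λ triangleFree x y xy → Equivalence.from (commonNeighbours≡0⇔ x y)
       (λ z (xz , yz) → triangleFree (x , y , z , xy , yz , E-sym xz)))
    (λ λ≡0 (a , b , c , ab , bc , ca) →
       Equivalence.to (commonNeighbours≡0⇔ a b) (λ≡0 a b ab) c (E-sym ca , bc))

  triangleFree⇒diamondFree : ¬ HasTriangle G → ¬ Diamond (E G)
  triangleFree⇒diamondFree triangleFree D = triangleFree (a , b , c , eab , ebc , E-sym eac)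
    where open Diamond D

  E+⇒E : ∀ {u v x y} → x ≢ u → x ≢ v → E+ G u v x y → E G x y
  E+⇒E _ _ (inj₁ xy) = xy
  E+⇒E x≢u _ (inj₂ (inj₁ (x≡u , _))) = ⊥-elim (x≢u x≡u)
  E+⇒E _ x≢v (inj₂ (inj₂ (x≡v , _))) = ⊥-elim (x≢v x≡v)

  E+⇒Eʳ : ∀ {u v x y} → y ≢ u → y ≢ v → E+ G u v x y → E G x y
  E+⇒Eʳ _ _ (inj₁ xy) = xy
  E+⇒Eʳ _ y≢v (inj₂ (inj₁ (_ , y≡v))) = ⊥-elim (y≢v y≡v)
  E+⇒Eʳ y≢u _ (inj₂ (inj₂ (_ , y≡u))) = ⊥-elim (y≢u y≡u)

  diamond-through : ∀ {u v a d} → u ≢ v → a ≢ d → CommonNeighbour u v a → CommonNeighbour u v d →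
                    Diamond (E+ G u v)
  diamond-through u≢v a≢d (ua , va) (ud , vd) =
    diamond _ _ _ _ (E⇒≢ ua ∘ ≡.sym) (E⇒≢ va ∘ ≡.sym) a≢d u≢v (E⇒≢ ud) (E⇒≢ vd)
      (inj₁ (E-sym ua)) (inj₁ (E-sym va)) (inj₂ (inj₁ (refl , refl))) (inj₁ ud) (inj₁ vd)

  module _ (triangleFree : ¬ HasTriangle G) where

    triangle-contains-new-edge : ∀ {u v x y z} → E+ G u v x y → E+ G u v x z → E+ G u v y z →
                                 UPair x y u v ⊎ UPair x z u v ⊎ UPair y z u v
    triangle-contains-new-edge (inj₂ xy) _ _ = inj₁ xy
    triangle-contains-new-edge (inj₁ _) (inj₂ xz) _ = inj₂ (inj₁ xz)
    triangle-contains-new-edge (inj₁ _) (inj₁ _) (inj₂ yz) = inj₂ (inj₂ yz)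
    triangle-contains-new-edge {x = x} {y} {z} (inj₁ xy) (inj₁ xz) (inj₁ yz) =
      ⊥-elim (triangleFree (x , y , z , xy , yz , E-sym xz))

    -- Otherwise uv would be an edge of both triangles abc and bcd other than bc, forcing a ∈ {b, c, d}.
    chord-is-new-edge : ∀ {u v} (D : Diamond (E+ G u v)) → UPair (Diamond.b D) (Diamond.c D) u v
    chord-is-new-edge (diamond _ _ _ _ ab ac ad _ _ _ eab eac ebc ebd ecd)
      with triangle-contains-new-edge eab eac ebc | triangle-contains-new-edge ebc ebd ecd
    ... | inj₂ (inj₂ bc-new) | _ = bc-new
    ... | _ | inj₁ bc-new = bc-new
    ... | inj₁ ab-new | inj₂ (inj₁ bd-new) = ⊥-elim ([ ab , ad ]′ (UPair-endpoint ab-new bd-new))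
    ... | inj₁ ab-new | inj₂ (inj₂ cd-new) = ⊥-elim ([ ac , ad ]′ (UPair-endpoint ab-new cd-new))
    ... | inj₂ (inj₁ ac-new) | inj₂ (inj₁ bd-new) = ⊥-elim ([ ab , ad ]′ (UPair-endpoint ac-new bd-new))
    ... | inj₂ (inj₁ ac-new) | inj₂ (inj₂ cd-new) = ⊥-elim ([ ac , ad ]′ (UPair-endpoint ac-new cd-new))

    apexes-common : ∀ {u v} (D : Diamond (E+ G u v)) →
                    CommonNeighbour u v (Diamond.a D) × CommonNeighbour u v (Diamond.d D)
    apexes-common D@(diamond _ _ _ _ ab ac _ _ bd cd eab eac _ ebd ecd) with chord-is-new-edge D
    ... | inj₁ (refl , refl) =
      (E-sym (E+⇒E ab ac eab) , E-sym (E+⇒E ab ac eac)) ,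
      (E+⇒Eʳ (bd ∘ ≡.sym) (cd ∘ ≡.sym) ebd , E+⇒Eʳ (bd ∘ ≡.sym) (cd ∘ ≡.sym) ecd)
    ... | inj₂ (refl , refl) =
      (E-sym (E+⇒E ac ab eac) , E-sym (E+⇒E ac ab eab)) ,
      (E+⇒Eʳ (cd ∘ ≡.sym) (bd ∘ ≡.sym) ecd , E+⇒Eʳ (cd ∘ ≡.sym) (bd ∘ ≡.sym) ebd)

    exactlyOneDiamond⇔ExactlyTwo : ∀ {u v} → u ≢ v →
                                   ExactlyOneDiamond (E+ G u v) ⇔ ExactlyTwo (CommonNeighbour u v)
    exactlyOneDiamond⇔ExactlyTwo {u} {v} u≢v = mk⇔ apexes diamond-on-apexes
      where
      apexes : ExactlyOneDiamond (E+ G u v) → ExactlyTwo (CommonNeighbour u v)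
      apexes (D , unique) = exactlyTwo a d ad aᶜ dᶜ only-apexes
        where
        open Diamond D
        aᶜ = proj₁ (apexes-common D)
        dᶜ = proj₂ (apexes-common D)
        only-apexes : ∀ z → CommonNeighbour u v z → z ≡ a ⊎ z ≡ d
        only-apexes z zᶜ@(uz , vz) with z ≟ a
        ... | yes z≡a = inj₁ z≡a
        ... | no z≢a = DiamondEdge-off-chord zu∈D (E⇒≢ uz ∘ ≡.sym) (E⇒≢ vz ∘ ≡.sym)
          where
          D′ = diamond-through u≢v z≢a zᶜ aᶜ
          zu∈D′ : DEdge D′ z u
          zu∈D′ = inj₁ (inj₁ (refl , refl))
          zu∈D : DiamondEdge a u v d z u
          zu∈D = DiamondEdge-cong (chord-is-new-edge D) (inj₁ (refl , refl))
                                  (Equivalence.from (unique D′ z u) zu∈D′)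
      diamond-on-apexes : ExactlyTwo (CommonNeighbour u v) → ExactlyOneDiamond (E+ G u v)
      diamond-on-apexes T = diamond-through u≢v fst≢snd P-fst P-snd , same
        where
        open ExactlyTwo T
        same : ∀ D′ → SameSubgraph (diamond-through u≢v fst≢snd P-fst P-snd) D′
        same D′ x y = mk⇔ (DiamondEdge-cong (UPair-sym chord) (UPair-sym apexes′))
                          (DiamondEdge-cong chord apexes′)
          where
          chord = chord-is-new-edge D′
          apexes′ = UPair-fst-snd (Diamond.ad D′) (proj₁ (apexes-common D′)) (proj₂ (apexes-common D′))

    exactlyOneDiamond⇔μ≡2 : ∀ {u v} → u ≢ v → ExactlyOneDiamond (E+ G u v) ⇔ commonNeighbours G u v ≡ 2
    exactlyOneDiamond⇔μ≡2 u≢v = ⇔-sym (commonNeighbours≡2⇔ _ _) ⇔-∘ exactlyOneDiamond⇔ExactlyTwo u≢v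

    neighbours-non-adjacent : ∀ {x y z} → E G x y → E G x z → ¬ E G z y
    neighbours-non-adjacent {x} {y} {z} xy xz zy = triangleFree (x , z , y , xz , zy , E-sym xy)

    module _ (μ≡2 : ∀ u v → u ≢ v → ¬ E G u v → commonNeighbours G u v ≡ 2) where

      common-pair : ∀ {u v} → u ≢ v → ¬ E G u v → ExactlyTwo (CommonNeighbour u v)
      common-pair u≢v ¬uv = Equivalence.to (commonNeighbours≡2⇔ _ _) (μ≡2 _ _ u≢v ¬uv)

      other-common : ∀ {x y z} → E G x y → E G x z → z ≢ y →
                     Σ (Fin n) λ w → CommonNeighbour z y w × w ≢ x ×
                                     (∀ w′ → CommonNeighbour z y w′ → w′ ≢ x → w′ ≡ w)
      other-common xy xz z≢y =
        ExactlyTwo.partner (common-pair z≢y (neighbours-non-adjacent xy xz)) (E-sym xz , E-sym xy)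

      Matched : Fin n → Fin n → Fin n → Fin n → Set
      Matched x y z w = (z ≡ y × w ≡ x) ⊎ (z ≢ y × w ≢ x × E G z w)

      Matched-sym : ∀ {x y z w} → Matched x y z w → Matched y x w z
      Matched-sym (inj₁ (z≡y , w≡x)) = inj₁ (w≡x , z≡y)
      Matched-sym (inj₂ (z≢y , w≢x , zw)) = inj₂ (w≢x , z≢y , E-sym zw)

      match : ∀ {x y z} → E G x y → E G x z → Σ (Fin n) λ w → E G y w × Matched x y z w
      match {x} {y} {z} xy xz with z ≟ y
      ... | yes z≡y = x , E-sym xy , inj₁ (z≡y , refl)
      ... | no z≢y with w , (zw , yw) , w≢x , _ ← other-common xy xz z≢y = w , yw , inj₂ (z≢y , w≢x , zw)

      match-unique : ∀ {x y z w w′} → E G x y → E G x z → E G y w → E G y w′ →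
                     Matched x y z w → Matched x y z w′ → w ≡ w′
      match-unique _ _ _ _ (inj₁ (_ , w≡x)) (inj₁ (_ , w′≡x)) = trans w≡x (≡.sym w′≡x)
      match-unique _ _ _ _ (inj₁ (z≡y , _)) (inj₂ (z≢y , _)) = ⊥-elim (z≢y z≡y)
      match-unique _ _ _ _ (inj₂ (z≢y , _)) (inj₁ (z≡y , _)) = ⊥-elim (z≢y z≡y)
      match-unique xy xz yw yw′ (inj₂ (z≢y , w≢x , zw)) (inj₂ (_ , w′≢x , zw′))
        with _ , _ , _ , unique ← other-common xy xz z≢y
        = trans (unique _ (zw , yw) w≢x) (≡.sym (unique _ (zw′ , yw′) w′≢x))

      across : ∀ {x y} → E G x y → Support (adj G x) → Support (adj G y)
      across xy (z , xz) = proj₁ (match xy xz) , proj₁ (proj₂ (match xy xz))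

      across-inverse : ∀ {x y} (xy : E G x y) (yx : E G y x) s → across yx (across xy s) ≡ s
      across-inverse xy yx (z , xz) = Support-≡ (match-unique yx yw xz′ xz wz′ (Matched-sym zw))
        where
        yw = proj₁ (proj₂ (match xy xz))
        zw = proj₂ (proj₂ (match xy xz))
        xz′ = proj₁ (proj₂ (match yx yw))
        wz′ = proj₂ (proj₂ (match yx yw))

      neighbourhood-↔ : ∀ {x y} → E G x y → Support (adj G x) ↔ Support (adj G y)
      neighbourhood-↔ xy =
        mk↔ₛ′ (across xy) (across (E-sym xy)) (across-inverse (E-sym xy) xy) (across-inverse xy (E-sym xy))

      degree-adjacent : ∀ {x y} → E G x y → degree G x ≡ degree G y
      degree-adjacent xy = count-cong-↔ (neighbourhood-↔ xy)

      degree-constant : ∀ x y → degree G x ≡ degree G y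
      degree-constant x y with x ≟ y | E? x y
      ... | yes refl | _ = refl
      ... | no _ | yes xy = degree-adjacent xy
      ... | no x≢y | no ¬xy = trans (degree-adjacent xw) (≡.sym (degree-adjacent yw))
        where
        xw = proj₁ (ExactlyTwo.P-fst (common-pair x≢y ¬xy))
        yw = proj₂ (ExactlyTwo.P-fst (common-pair x≢y ¬xy))

  4-cycle⇒¬complete : ¬ HasTriangle G → Has4Cycle G → ¬ IsComplete G
  4-cycle⇒¬complete triangleFree (a , b , c , _ , (_ , a≢c , _) , (ab , bc , _)) complete =
    triangleFree (a , b , c , ab , bc , complete c a (a≢c ∘ ≡.sym))

  adjacent-if-distinct? : ∀ x y → Dec (x ≢ y → E G x y)
  adjacent-if-distinct? x y = ¬? (x ≟ y) →-dec E? x y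

  ¬complete⇒non-edge : ¬ IsComplete G → Σ (Fin n) λ x → Σ (Fin n) λ y → x ≢ y × ¬ E G x y
  ¬complete⇒non-edge ¬complete
    with x , ¬x-universal ← ¬∀⟶∃¬ n _ (λ x → all? (adjacent-if-distinct? x)) ¬complete
    with y , ¬x→y ← ¬∀⟶∃¬ n _ (adjacent-if-distinct? x) ¬x-universal
    = x , y , (λ x≡y → ¬x→y (λ x≢y → ⊥-elim (x≢y x≡y))) , (λ xy → ¬x→y (λ _ → xy))

  ¬complete⇒4-cycle : (∀ u v → u ≢ v → ¬ E G u v → commonNeighbours G u v ≡ 2) →
                      ¬ IsComplete G → Has4Cycle G
  ¬complete⇒4-cycle μ≡2 ¬complete
    with x , y , x≢y , ¬xy ← ¬complete⇒non-edge ¬complete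
    with exactlyTwo p q p≢q (xp , yp) (xq , yq) _ ← Equivalence.to (commonNeighbours≡2⇔ x y) (μ≡2 x y x≢y ¬xy)
    = x , p , y , q ,
      (E⇒≢ xp , x≢y , E⇒≢ xq , E⇒≢ yp ∘ ≡.sym , p≢q , E⇒≢ yq) ,
      (xp , E-sym yp , yq , E-sym xq)

theorem3p1 : ∀ (n : ℕ) (G : Graph n) →
    (UniquelyDiamondSaturated G × Girth4 G) ⇔ ∃ (λ (k : ℕ) → StronglyRegular G n k 0 2)
theorem3p1 n G = mk⇔ forward backward
  where
  forward : UniquelyDiamondSaturated G × Girth4 G → ∃ λ k → StronglyRegular G n k 0 2
  forward ((_ , saturated) , triangleFree , cycle@(a , b , _ , _ , _ , ab , _)) =
    degree G a , refl , 4-cycle⇒¬complete G triangleFree cycle , (λ edgeless → edgeless a b ab) ,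
    (λ x → degree-constant G triangleFree μ≡2 x a) ,
    Equivalence.to (triangleFree⇔λ≡0 G) triangleFree , μ≡2
    where
    μ≡2 : ∀ u v → u ≢ v → ¬ E G u v → commonNeighbours G u v ≡ 2
    μ≡2 u v u≢v ¬uv = Equivalence.to (exactlyOneDiamond⇔μ≡2 G triangleFree u≢v) (saturated u v u≢v ¬uv)

  backward : ∃ (λ k → StronglyRegular G n k 0 2) → UniquelyDiamondSaturated G × Girth4 G
  backward (_ , _ , ¬complete , _ , _ , λ≡0 , μ≡2) =
    (triangleFree⇒diamondFree G triangleFree , saturated) ,
    triangleFree , ¬complete⇒4-cycle G μ≡2 ¬complete
    where
    triangleFree : ¬ HasTriangle G
    triangleFree = Equivalence.from (triangleFree⇔λ≡0 G) λ≡0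
    saturated : ∀ u v → u ≢ v → ¬ E G u v → ExactlyOneDiamond (E+ G u v)
    saturated u v u≢v ¬uv = Equivalence.from (exactlyOneDiamond⇔μ≡2 G triangleFree u≢v) (μ≡2 u v u≢v ¬uv)
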